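{- Let $\mathcal{G}$ be a game with set of states $S$, set $S_{\mathtt{Sat}}\subseteq S$ of states owned by player $\mathtt{Sat}$, and Borel objective $\Omega$, and let $s,s'\in S_{\mathtt{Sat}}$. Suppose that for every $T\subseteq S_{\mathtt{Sat}}$ with $s\in T$ and $s'\notin T$ we have $\mathrm{val}(T)=0$. Then $I(s)\le I(s')$.
   Context: A game is given by a finite directed graph $(S,\Delta)$ in which every state has at least one successor, a partition of $S$ into $S_{\mathtt{Sat}}$ (states controlled by player $\mathtt{Sat}$) and $S_{\mathtt{Unsat}}$ (states controlled by player $\mathtt{Unsat}$), an initial state $init$, and a Borel objective $\Omega\subseteq S^\omega$. A play is an infinite path in the graph starting at $init$; a strategy of a player maps each finite history ending in a state of that player to a successor of that state; a strategy of $\mathtt{Sat}$ (resp. $\mathtt{Unsat}$) is winning if every play consistent with it lies in $\Omega$ (resp. outside $\Omega$). For $T\subseteq S$, let $\mathcal{G}_T$ be the game on the same graph with the same initial state and objective, in which $\mathtt{Sat}$ controls the states in $T$ and $\mathtt{Unsat}$ those in $S\setminus T$; $\mathrm{val}(T)=1$ if $\mathtt{Sat}$ has a winning strategy in $\mathcal{G}_T$ and $\mathrm{val}(T)=0$ otherwise (in which case $\mathtt{Unsat}$ has one, by Borel determinacy). For $s\in S_{\mathtt{Sat}}$, with $n=|S_{\mathtt{Sat}}|$ and $\Pi$ the set of bijections $\pi:S_{\mathtt{Sat}}\to\{1,\dots,n\}$, the importance is $I(s)=\frac{1}{n!}\sum_{\pi\in\Pi}\big(\mathrm{val}(S^\pi_{\ge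 s})-\mathrm{val}(S^\pi_{\ge s}\setminus\{s\})\big)$, where $S^\pi_{\ge s}=\{s'\in S_{\mathtt{Sat}}:\pi(s')\ge\pi(s)\}$. -}

module Defs where

open import Data.Nat as ℕ using (ℕ; zero; suc; _!)
open import Data.Nat.Properties using (_!≢0)
open import Data.Bool using (Bool; true; false; if_then_else_)
open import Data.Fin using (Fin; _≟_)
open import Data.Fin.Subset using (Subset; _∈_; _∉_; ⁅_⁆; _∪_; ⊥; _-_; ∣_∣)
open import Data.Fin.Subset.Properties using (_∈?_)
open import Data.List using (List; []; _∷_; map; concatMap; foldr; filter; allFin)
open import Data.Integer as ℤ using (ℤ; +_)
open import Data.Rational as ℚ using (ℚ)
open import Data.Product using (Σ; ∃; _×_; proj₁)
open import Data.Unit using (⊤)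
open import Relation.Nullary using (¬_; does)
open import Relation.Binary.PropositionalEquality using (_≡_)
open import Function.Bundles using (_⇔_)

Seq : ℕ → Set
Seq m = ℕ → Fin m

HasPrefix : ∀ {m} → List (Fin m) → Seq m → Set
HasPrefix []       p = ⊤
HasPrefix (x ∷ w)  p = (p 0 ≡ x) × HasPrefix w (λ k → p (suc k))

-- Codes of Borel subsets of S^ω: generated from the basic open cylinder
-- sets by complement and countable union.
data Borel (m : ℕ) : Set where
  cyl   : List (Fin m) → Borel m
  compl : Borel m → Borel m
  union : (ℕ → Borel m) → Borel m

⟦_⟧ : ∀ {m} → Borel m → Seq m → Set
⟦ cyl w   ⟧ p = HasPrefix w p
⟦ compl b ⟧ p = ¬ (⟦ b ⟧ p)
⟦ union f ⟧ p = ∃ λ i → ⟦ f i ⟧ p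

record Game (m : ℕ) : Set where
  field
    Δ     : Fin m → Fin m → Bool
    total : ∀ s → ∃ λ t → Δ s t ≡ true
    SSat  : Subset m
    init  : Fin m
    Ω     : Borel m

module _ {m : ℕ} (G : Game m) where
  open Game G

  history : Seq m → ℕ → List (Fin m)
  history p zero    = []
  history p (suc k) = p 0 ∷ history (λ i → p (suc i)) k

  IsPlay : Seq m → Set
  IsPlay p = (p 0 ≡ init) × (∀ k → Δ (p k) (p (suc k)) ≡ true)

  -- strategy of Sat in G_T: maps a history (the states before the current
  -- one) and a current state in T to a successor of that state
  SatStrategy : Subset m → Set
  SatStrategy T = (h : List (Fin m)) (s : Fin m) → s ∈ T → Σ (Fin m) (λ t → Δ s t ≡ true)

  ConsistentWith : (T : Subset m) → SatStrategy T → Seq m → Set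
  ConsistentWith T σ p = ∀ k → (h : p k ∈ T) → p (suc k) ≡ proj₁ (σ (history p k) (p k) h)

  Winning : (T : Subset m) → SatStrategy T → Set
  Winning T σ = ∀ p → IsPlay p → ConsistentWith T σ p → ⟦ Ω ⟧ p

  SatWins : Subset m → Set
  SatWins T = Σ (SatStrategy T) (Winning T)

  -- v is the value function: v T = 1 (true) iff Sat wins G_T, else 0 (false)
  IsVal : (Subset m → Bool) → Set
  IsVal v = ∀ T → (v T ≡ true) ⇔ SatWins T

  insertAll : {A : Set} → A → List A → List (List A)
  insertAll x []       = (x ∷ []) ∷ []
  insertAll x (y ∷ ys) = (x ∷ y ∷ ys) ∷ map (y ∷_) (insertAll x ys)

  perms : {A : Set} → List A → List (List A)
  perms []       = [] ∷ []
  perms (x ∷ xs) = concatMap (insertAll x) (perms xs)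

  satList : List (Fin m)
  satList = filter (_∈? SSat) (allFin m)

  -- A bijection π : S_Sat → {1..n} is represented by the list l of Sat
  -- states in increasing π-order (π(l_i) = i+1); Π = perms satList.
  -- S^π_{≥ s} = states from s onwards in l.
  suffixFrom : Fin m → List (Fin m) → List (Fin m)
  suffixFrom s []       = []
  suffixFrom s (x ∷ xs) = if does (x ≟ s) then x ∷ xs else suffixFrom s xs

  toSubset : List (Fin m) → Subset m
  toSubset = foldr (λ x S → ⁅ x ⁆ ∪ S) ⊥

  Sge : Fin m → List (Fin m) → Subset m
  Sge s l = toSubset (suffixFrom s l)

  valℤ : (Subset m → Bool) → Subset m → ℤ
  valℤ v T = if v T then + 1 else + 0

  marginal : (Subset m → Bool) → Fin m → List (Fin m) → ℤ
  marginal v s l = valℤ v (Sge s l) ℤ.- valℤ v (Sge s l - s)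

  sumℤ : List ℤ → ℤ
  sumℤ = foldr ℤ._+_ (+ 0)

  Importance : (Subset m → Bool) → Fin m → ℚ
  Importance v s =
    ℚ._/_ (sumℤ (map (marginal v s) (perms satList))) (∣ SSat ∣ !) {{∣ SSat ∣ !≢0}}

-- Let τ be the transposition of s and s′. Relabelling every ordering of the Sat states by τ
-- permutes the list of all orderings, so the sum defining I(s′) may be taken over the
-- marginal contributions of s′ in the relabelled orderings τ ∘ π. It then suffices to compare,
-- for each ordering π with A = S^π_{≥s}, the contribution of s in π with that of s′ in τ ∘ π.
-- If s′ ∈ A, then S^{τπ}_{≥s′} = A, and val(A ∖ {s′}) = 0 because A ∖ {s′} contains s but not s′.
-- If s′ ∉ A, then val(A) = 0 for the same reason, and S^{τπ}_{≥s′} ∖ {s′} = A ∖ {s}.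
module Submission where

open import Defs
open import Data.Bool using (Bool; true; false)
open import Data.Nat using (ℕ; suc; z≤n; NonZero; _!)
open import Data.Nat.Properties using (_!≢0)
open import Data.Integer as ℤ using (ℤ; +_)
import Data.Integer.Properties as ℤP
open import Data.Rational as ℚ using (_≤_)
import Data.Rational.Properties as ℚP
open import Data.Rational.Unnormalised using (mkℚᵘ; *≤*)
import Data.Rational.Unnormalised.Properties as ℚᵘP
open import Data.Fin using (Fin; _≟_)
open import Data.Fin.Permutation.Components using (transpose)
open import Data.Fin.Subset using (Subset; _∈_; _∉_; _⊆_; _-_; _─_; ⁅_⁆; outside; ∣_∣)
open import Data.Fin.Subset.Properties
  using (_∈?_; ⊆-antisym; p─q⊆p; x∈p∧x≢y⇒x∈p-y; x∈⁅x⁆; x∈⁅y⁆⇒x≡y; x∈p∪q⁺; x∈p∪q⁻; ∉⊥)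
open import Data.Vec using (_∷_; here; there)
open import Data.List using (List; []; _∷_; _++_; map; concatMap; allFin)
open import Data.List.Properties
  using (map-∘; map-concatMap; concatMap-map; concatMap-++; concatMap-cong; map-id-local)
open import Data.List.Membership.Propositional using (find) renaming (_∈_ to _∈ˡ_)
open import Data.List.Membership.Propositional.Properties
  using (∈-∃++; ∈-concatMap⁻; ∈-map⁻; ∈-map⁺; ∈-filter⁺; ∈-allFin)
open import Data.List.Relation.Unary.Any as Any using (here; there)
open import Data.List.Relation.Unary.All as All using (All; []; _∷_)
open import Data.List.Relation.Unary.All.Properties using (all-filter)
open import Data.List.Relation.Unary.AllPairs using (_∷_)
open import Data.List.Relation.Unary.Unique.Propositional using (Unique)
import Data.List.Relation.Unary.Unique.Propositional.Properties as Uniqueₚ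
open import Data.List.Relation.Binary.Permutation.Propositional
open import Data.List.Relation.Binary.Permutation.Propositional.Properties
  using (++⁺ˡ; ++⁺; shift; shifts; map⁺; ∈-resp-↭; All-resp-↭)
open import Data.List.Relation.Binary.Permutation.Setoid.Properties using (Unique-resp-↭; foldr-commMonoid)
open import Data.Product using (∃; _,_)
open import Data.Sum using (inj₁; inj₂)
open import Function using (_∘_)
open import Function.Bundles using (_⇔_; mk⇔; Equivalence)
open import Function.Construct.Composition using (_⇔-∘_)
open import Function.Construct.Symmetry using (⇔-sym)
open import Function.Definitions using (Injective)
open import Relation.Binary.PropositionalEquality
  using (_≡_; _≢_; refl; sym; cong; cong₂; subst; module ≡-Reasoning)
import Relation.Binary.PropositionalEquality as ≡
open import Relation.Nullary using (Dec; yes; no; contradiction)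
open import Relation.Nullary.Decidable using (dec-true; dec-false)

variable
  A B C : Set

concatMap⁺ : (f : A → List B) {xs ys : List A} → xs ↭ ys → concatMap f xs ↭ concatMap f ys
concatMap⁺ f refl         = ↭-refl
concatMap⁺ f (prep x p)   = ++⁺ˡ (f x) (concatMap⁺ f p)
concatMap⁺ f (swap x y p) = ↭-trans (shifts (f x) (f y)) (++⁺ˡ (f y) (++⁺ˡ (f x) (concatMap⁺ f p)))
concatMap⁺ f (trans p q)  = ↭-trans (concatMap⁺ f p) (concatMap⁺ f q)

concatMap-cong-↭ : {f g : A → List B} → (∀ x → f x ↭ g x) → (xs : List A) →
                   concatMap f xs ↭ concatMap g xs
concatMap-cong-↭ f↭g []       = ↭-refl
concatMap-cong-↭ f↭g (x ∷ xs) = ++⁺ (f↭g x) (concatMap-cong-↭ f↭g xs)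

concatMap-concatMap : (f : B → List C) (g : A → List B) (xs : List A) →
                      concatMap f (concatMap g xs) ≡ concatMap (concatMap f ∘ g) xs
concatMap-concatMap f g []       = refl
concatMap-concatMap f g (x ∷ xs) =
  ≡.trans (concatMap-++ f (g x) (concatMap g xs)) (cong (concatMap f (g x) ++_) (concatMap-concatMap f g xs))

concatMap-∷ : (g : A → B) (h : A → List B) (xs : List A) →
              concatMap (λ x → g x ∷ h x) xs ↭ map g xs ++ concatMap h xs
concatMap-∷ g h []       = ↭-refl
concatMap-∷ g h (x ∷ xs) =
  prep (g x) (↭-trans (++⁺ˡ (h x) (concatMap-∷ g h xs)) (shifts (h x) (map g xs)))

∈⇒↭∷ : {x : A} {xs : List A} → x ∈ˡ xs → ∃ λ ys → xs ↭ x ∷ ys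
∈⇒↭∷ x∈xs with ys , zs , refl ← ∈-∃++ x∈xs = ys ++ zs , shift _ ys zs

∈-map-involutive : {f : A → A} → (∀ x → f (f x) ≡ x) → ∀ {y} (xs : List A) →
                   y ∈ˡ map f xs ⇔ f y ∈ˡ xs
∈-map-involutive {f = f} f-inv {y} xs = mk⇔ to from
  where
    to : y ∈ˡ map f xs → f y ∈ˡ xs
    to y∈ with x , x∈xs , refl ← ∈-map⁻ f y∈ = subst (_∈ˡ xs) (sym (f-inv x)) x∈xs
    from : f y ∈ˡ xs → y ∈ˡ map f xs
    from fy∈xs = subst (_∈ˡ map f xs) (f-inv y) (∈-map⁺ f fy∈xs)

transpose-matchˡ : ∀ {n} (i j : Fin n) → transpose i j i ≡ j
transpose-matchˡ i j rewrite dec-true (i ≟ i) refl = refl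

transpose-matchʳ : ∀ {n} (i j : Fin n) → transpose i j j ≡ i
transpose-matchʳ i j with j ≟ i
... | yes j≡i = j≡i
... | no  _   rewrite dec-true (j ≟ j) refl = refl

transpose-fix : ∀ {n} {i j k : Fin n} → k ≢ i → k ≢ j → transpose i j k ≡ k
transpose-fix {i = i} {j} {k} k≢i k≢j rewrite dec-false (k ≟ i) k≢i | dec-false (k ≟ j) k≢j = refl

transpose-involutive : ∀ {n} (i j k : Fin n) → transpose i j (transpose i j k) ≡ k
transpose-involutive i j k = by-cases (k ≟ i) (k ≟ j)
  where
    by-cases : Dec (k ≡ i) → Dec (k ≡ j) → transpose i j (transpose i j k) ≡ k
    by-cases (yes refl) _          = ≡.trans (cong (transpose k j) (transpose-matchˡ k j)) (transpose-matchʳ k j)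
    by-cases (no _)     (yes refl) = ≡.trans (cong (transpose i k) (transpose-matchʳ i k)) (transpose-matchˡ i k)
    by-cases (no k≢i)   (no k≢j)   = ≡.trans (cong (transpose i j) (transpose-fix k≢i k≢j)) (transpose-fix k≢i k≢j)

transpose-injective : ∀ {n} (i j : Fin n) → Injective _≡_ _≡_ (transpose i j)
transpose-injective i j {x} {y} τx≡τy = begin
  x                               ≡⟨ transpose-involutive i j x ⟨
  transpose i j (transpose i j x) ≡⟨ cong (transpose i j) τx≡τy ⟩
  transpose i j (transpose i j y) ≡⟨ transpose-involutive i j y ⟩
  y                               ∎
  where open ≡-Reasoning

map-transpose-fix : ∀ {n} {i j : Fin n} {xs : List (Fin n)} → All (i ≢_) xs → All (j ≢_) xs →
                    map (transpose i j) xs ≡ xs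
map-transpose-fix i∉xs j∉xs =
  map-id-local (All.zipWith (λ (i≢x , j≢x) → transpose-fix (i≢x ∘ sym) (j≢x ∘ sym)) (i∉xs , j∉xs))

map-transpose-↭ : ∀ {n} {i j : Fin n} {xs : List (Fin n)} → i ≢ j → Unique xs → i ∈ˡ xs → j ∈ˡ xs →
                  map (transpose i j) xs ↭ xs
map-transpose-↭ {i = i} {j} {xs} i≢j xs-unique i∈xs j∈xs
  with R₁ , xs↭iR₁ ← ∈⇒↭∷ i∈xs
  with R , R₁↭jR ← ∈⇒↭∷ (Any.tail (i≢j ∘ sym) (∈-resp-↭ xs↭iR₁ j∈xs))
  with xs↭ijR ← ↭-trans xs↭iR₁ (prep i R₁↭jR)
  with (_ ∷ i∉R) ∷ j∉R ∷ _ ← Unique-resp-↭ (≡.setoid _) (↭⇒↭ₛ xs↭ijR) xs-unique = begin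
    map (transpose i j) xs                                    ↭⟨ map⁺ (transpose i j) xs↭ijR ⟩
    transpose i j i ∷ transpose i j j ∷ map (transpose i j) R ≡⟨ cong₂ (λ a b → a ∷ b ∷ map (transpose i j) R)
                                                                  (transpose-matchˡ i j) (transpose-matchʳ i j) ⟩
    j ∷ i ∷ map (transpose i j) R                             ≡⟨ cong (λ ys → j ∷ i ∷ ys) (map-transpose-fix i∉R j∉R) ⟩
    j ∷ i ∷ R                                                 ↭⟨ swap j i refl ⟩
    i ∷ j ∷ R                                                 ↭⟨ xs↭ijR ⟨
    xs                                                        ∎
  where open PermutationReasoning

x∈p─q⇒x∉q : ∀ {n} (p q : Subset n) {x} → x ∈ p ─ q → x ∉ q
x∈p─q⇒x∉q (_ ∷ p) (outside ∷ q) here      ()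
x∈p─q⇒x∉q (_ ∷ p) (_       ∷ q) (there h) (there h′) = x∈p─q⇒x∉q p q h h′

x∈p-y⇒x≢y : ∀ {n} (p : Subset n) {x y} → x ∈ p - y → x ≢ y
x∈p-y⇒x≢y p {y = y} x∈p-y refl = x∈p─q⇒x∉q p ⁅ y ⁆ x∈p-y (x∈⁅x⁆ y)

module _ {n : ℕ} {i j : Fin n} {P Q : Subset n}
         (Q-preimage : ∀ {y} → y ∈ Q ⇔ transpose i j y ∈ P) where

  preimage-transpose-≡ : i ∈ P → j ∈ P → Q ≡ P
  preimage-transpose-≡ i∈P j∈P = ⊆-antisym Q⊆P P⊆Q
    where
      closed : ∀ {z} → z ∈ P → transpose i j z ∈ P
      closed {z} z∈P = by-cases (z ≟ i) (z ≟ j)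
        where
          by-cases : Dec (z ≡ i) → Dec (z ≡ j) → transpose i j z ∈ P
          by-cases (yes refl) _          = subst (_∈ P) (sym (transpose-matchˡ i j)) j∈P
          by-cases (no _)     (yes refl) = subst (_∈ P) (sym (transpose-matchʳ i j)) i∈P
          by-cases (no z≢i)   (no z≢j)   = subst (_∈ P) (sym (transpose-fix z≢i z≢j)) z∈P
      Q⊆P : Q ⊆ P
      Q⊆P {y} y∈Q = subst (_∈ P) (transpose-involutive i j y) (closed (Equivalence.to Q-preimage y∈Q))
      P⊆Q : P ⊆ Q
      P⊆Q y∈P = Equivalence.from Q-preimage (closed y∈P)

  preimage-transpose-─ : j ∉ P → Q - j ≡ P - i
  preimage-transpose-─ j∉P = ⊆-antisym Q-j⊆P-i P-i⊆Q-j
    where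
      Q-j⊆P-i : Q - j ⊆ P - i
      Q-j⊆P-i {y} y∈Q-j = x∈p∧x≢y⇒x∈p-y (subst (_∈ P) (transpose-fix y≢i y≢j) τy∈P) y≢i
        where
          y≢j : y ≢ j
          y≢j = x∈p-y⇒x≢y Q y∈Q-j
          τy∈P : transpose i j y ∈ P
          τy∈P = Equivalence.to Q-preimage (p─q⊆p Q ⁅ j ⁆ y∈Q-j)
          y≢i : y ≢ i
          y≢i refl = j∉P (subst (_∈ P) (transpose-matchˡ i j) τy∈P)
      P-i⊆Q-j : P - i ⊆ Q - j
      P-i⊆Q-j {y} y∈P-i = x∈p∧x≢y⇒x∈p-y (Equivalence.from Q-preimage τy∈P) y≢j
        where
          y∈P : y ∈ P
          y∈P = p─q⊆p P ⁅ i ⁆ y∈P-i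
          y≢j : y ≢ j
          y≢j refl = j∉P y∈P
          τy∈P : transpose i j y ∈ P
          τy∈P = subst (_∈ P) (sym (transpose-fix (x∈p-y⇒x≢y P y∈P-i) y≢j)) y∈P

/-monoˡ-≤ : ∀ {p q : ℤ} (d : ℕ) .{{_ : NonZero d}} → p ℤ.≤ q → p ℚ./ d ≤ q ℚ./ d
/-monoˡ-≤ {p} {q} (suc k) p≤q = ℚP.toℚᵘ-cancel-≤
  (ℚᵘP.≤-respˡ-≃ (ℚᵘP.≃-sym (ℚP.toℚᵘ-fromℚᵘ (mkℚᵘ p k)))
    (ℚᵘP.≤-respʳ-≃ (ℚᵘP.≃-sym (ℚP.toℚᵘ-fromℚᵘ (mkℚᵘ q k)))
      (*≤* (ℤP.*-monoʳ-≤-nonNeg (+ suc k) p≤q))))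

module _ {m : ℕ} (G : Game m) where

  open Game G using (SSat)

  -- The right-hand side is symmetric in x and y up to swapping the first two entries and the two
  -- middle blocks, which is what makes insertAll-comm an induction on zs.
  concatMap-insertAll-∷ : ∀ {A : Set} (x y z : A) zs →
    concatMap (insertAll G x) (insertAll G y (z ∷ zs)) ↭
      (x ∷ y ∷ z ∷ zs) ∷ (y ∷ x ∷ z ∷ zs) ∷
        (map (y ∷_) (map (z ∷_) (insertAll G x zs)) ++ map (x ∷_) (map (z ∷_) (insertAll G y zs)) ++
         map (z ∷_) (concatMap (insertAll G x) (insertAll G y zs)))
  concatMap-insertAll-∷ {A} x y z zs =
    prep _ (prep _ (++⁺ˡ (map (y ∷_) (map (z ∷_) (insertAll G x zs))) insert-x-after-z))
    where
      open PermutationReasoning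
      Q : List (List A)
      Q = insertAll G y zs
      insert-x-after-z : concatMap (insertAll G x) (map (z ∷_) Q) ↭
                         map (x ∷_) (map (z ∷_) Q) ++ map (z ∷_) (concatMap (insertAll G x) Q)
      insert-x-after-z = begin
        concatMap (insertAll G x) (map (z ∷_) Q)
          ≡⟨ concatMap-map (insertAll G x) (z ∷_) Q ⟩
        concatMap (λ q → (x ∷ z ∷ q) ∷ map (z ∷_) (insertAll G x q)) Q
          ↭⟨ concatMap-∷ (λ q → x ∷ z ∷ q) (map (z ∷_) ∘ insertAll G x) Q ⟩
        map (λ q → x ∷ z ∷ q) Q ++ concatMap (map (z ∷_) ∘ insertAll G x) Q
          ≡⟨ cong₂ _++_ (map-∘ Q) (sym (map-concatMap (z ∷_) (insertAll G x) Q)) ⟩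
        map (x ∷_) (map (z ∷_) Q) ++ map (z ∷_) (concatMap (insertAll G x) Q) ∎

  insertAll-comm : ∀ {A : Set} (x y : A) zs →
    concatMap (insertAll G x) (insertAll G y zs) ↭ concatMap (insertAll G y) (insertAll G x zs)
  insertAll-comm x y []       = swap _ _ refl
  insertAll-comm {A} x y (z ∷ zs) = begin
    concatMap (insertAll G x) (insertAll G y (z ∷ zs))
      ↭⟨ concatMap-insertAll-∷ x y z zs ⟩
    (x ∷ y ∷ z ∷ zs) ∷ (y ∷ x ∷ z ∷ zs) ∷ (Y ++ X ++ map (z ∷_) (concatMap (insertAll G x) (insertAll G y zs)))
      ↭⟨ swap _ _ (↭-trans (shifts Y X) (++⁺ˡ X (++⁺ˡ Y (map⁺ (z ∷_) (insertAll-comm x y zs))))) ⟩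
    (y ∷ x ∷ z ∷ zs) ∷ (x ∷ y ∷ z ∷ zs) ∷ (X ++ Y ++ map (z ∷_) (concatMap (insertAll G y) (insertAll G x zs)))
      ↭⟨ concatMap-insertAll-∷ y x z zs ⟨
    concatMap (insertAll G y) (insertAll G x (z ∷ zs)) ∎
    where
      open PermutationReasoning
      X Y : List (List A)
      Y = map (y ∷_) (map (z ∷_) (insertAll G x zs))
      X = map (x ∷_) (map (z ∷_) (insertAll G y zs))

  perms⁺ : {xs ys : List A} → xs ↭ ys → perms G xs ↭ perms G ys
  perms⁺ refl        = ↭-refl
  perms⁺ (prep x p)  = concatMap⁺ (insertAll G x) (perms⁺ p)
  perms⁺ {xs = x ∷ y ∷ xs} {ys = .y ∷ .x ∷ ys} (swap x y p) = begin
    concatMap (insertAll G x) (concatMap (insertAll G y) (perms G xs))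
      ↭⟨ concatMap⁺ (insertAll G x) (concatMap⁺ (insertAll G y) (perms⁺ p)) ⟩
    concatMap (insertAll G x) (concatMap (insertAll G y) (perms G ys))
      ≡⟨ concatMap-concatMap (insertAll G x) (insertAll G y) (perms G ys) ⟩
    concatMap (concatMap (insertAll G x) ∘ insertAll G y) (perms G ys)
      ↭⟨ concatMap-cong-↭ (insertAll-comm x y) (perms G ys) ⟩
    concatMap (concatMap (insertAll G y) ∘ insertAll G x) (perms G ys)
      ≡⟨ concatMap-concatMap (insertAll G y) (insertAll G x) (perms G ys) ⟨
    concatMap (insertAll G y) (concatMap (insertAll G x) (perms G ys)) ∎
    where open PermutationReasoning
  perms⁺ (trans p q) = ↭-trans (perms⁺ p) (perms⁺ q)

  insertAll-map : (f : A → B) (x : A) (xs : List A) →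
                  insertAll G (f x) (map f xs) ≡ map (map f) (insertAll G x xs)
  insertAll-map f x []       = refl
  insertAll-map f x (y ∷ ys) = cong ((f x ∷ f y ∷ map f ys) ∷_) (begin
    map (f y ∷_) (insertAll G (f x) (map f ys))   ≡⟨ cong (map (f y ∷_)) (insertAll-map f x ys) ⟩
    map (f y ∷_) (map (map f) (insertAll G x ys)) ≡⟨ map-∘ (insertAll G x ys) ⟨
    map (map f ∘ (y ∷_)) (insertAll G x ys)       ≡⟨ map-∘ (insertAll G x ys) ⟩
    map (map f) (map (y ∷_) (insertAll G x ys))   ∎)
    where open ≡-Reasoning

  perms-map : (f : A → B) (xs : List A) → perms G (map f xs) ≡ map (map f) (perms G xs)
  perms-map f []       = refl
  perms-map f (x ∷ xs) = begin
    concatMap (insertAll G (f x)) (perms G (map f xs))       ≡⟨ cong (concatMap (insertAll G (f x))) (perms-map f xs) ⟩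
    concatMap (insertAll G (f x)) (map (map f) (perms G xs)) ≡⟨ concatMap-map (insertAll G (f x)) (map f) (perms G xs) ⟩
    concatMap (insertAll G (f x) ∘ map f) (perms G xs)       ≡⟨ concatMap-cong (insertAll-map f x) (perms G xs) ⟩
    concatMap (map (map f) ∘ insertAll G x) (perms G xs)     ≡⟨ map-concatMap (map f) (insertAll G x) (perms G xs) ⟨
    map (map f) (concatMap (insertAll G x) (perms G xs))     ∎
    where open ≡-Reasoning

  ∈-insertAll⇒↭ : {l : List A} {x : A} (xs : List A) → l ∈ˡ insertAll G x xs → l ↭ x ∷ xs
  ∈-insertAll⇒↭ []       (here refl) = ↭-refl
  ∈-insertAll⇒↭ (y ∷ ys) (here refl) = ↭-refl
  ∈-insertAll⇒↭ {x = x} (y ∷ ys) (there l∈)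
    with q , q∈ , refl ← ∈-map⁻ (y ∷_) l∈ = ↭-trans (prep y (∈-insertAll⇒↭ ys q∈)) (swap y x refl)

  ∈-perms⇒↭ : {l : List A} (xs : List A) → l ∈ˡ perms G xs → l ↭ xs
  ∈-perms⇒↭ []       (here refl) = ↭-refl
  ∈-perms⇒↭ (x ∷ xs) l∈
    with q , q∈ , l∈q ← find (∈-concatMap⁻ (insertAll G x) l∈) =
    ↭-trans (∈-insertAll⇒↭ q l∈q) (prep x (∈-perms⇒↭ xs q∈))

  satList-unique : Unique (satList G)
  satList-unique = Uniqueₚ.filter⁺ (_∈? SSat) (Uniqueₚ.allFin⁺ m)

  ∈-satList : ∀ {x} → x ∈ SSat → x ∈ˡ satList G
  ∈-satList x∈SSat = ∈-filter⁺ (_∈? SSat) (∈-allFin _) x∈SSat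

  All-∈-satList : All (_∈ SSat) (satList G)
  All-∈-satList = all-filter (_∈? SSat) (allFin m)

  sumℤ-↭ : {xs ys : List ℤ} → xs ↭ ys → sumℤ G xs ≡ sumℤ G ys
  sumℤ-↭ p = foldr-commMonoid (≡.setoid ℤ) ℤP.+-0-isCommutativeMonoid (↭⇒↭ₛ p)

  sumℤ-map-mono : {f g : A → ℤ} (xs : List A) → (∀ {x} → x ∈ˡ xs → f x ℤ.≤ g x) →
                  sumℤ G (map f xs) ℤ.≤ sumℤ G (map g xs)
  sumℤ-map-mono []       f≤g = ℤP.≤-refl
  sumℤ-map-mono (x ∷ xs) f≤g = ℤP.+-mono-≤ (f≤g (here refl)) (sumℤ-map-mono xs (f≤g ∘ there))

  sumℤ-perms-transpose : ∀ {s s' : Fin m} {L : List (Fin m)} → s ≢ s' → Unique L → s ∈ˡ L → s' ∈ˡ L →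
    (f : List (Fin m) → ℤ) → sumℤ G (map (f ∘ map (transpose s s')) (perms G L)) ≡ sumℤ G (map f (perms G L))
  sumℤ-perms-transpose {s} {s'} {L} s≢s' L-unique s∈L s'∈L f = begin
    sumℤ G (map (f ∘ map τ) (perms G L))     ≡⟨ cong (sumℤ G) (map-∘ (perms G L)) ⟩
    sumℤ G (map f (map (map τ) (perms G L))) ≡⟨ cong (sumℤ G ∘ map f) (perms-map τ L) ⟨
    sumℤ G (map f (perms G (map τ L)))       ≡⟨ sumℤ-↭ (map⁺ f (perms⁺ (map-transpose-↭ s≢s' L-unique s∈L s'∈L))) ⟩
    sumℤ G (map f (perms G L))               ∎
    where
      open ≡-Reasoning
      τ : Fin m → Fin m
      τ = transpose s s'

  ∈-toSubset : ∀ {y} l → y ∈ toSubset G l ⇔ y ∈ˡ l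
  ∈-toSubset l = mk⇔ (to l) (from l)
    where
      to : ∀ {y} l → y ∈ toSubset G l → y ∈ˡ l
      to []      y∈⊥ = contradiction y∈⊥ ∉⊥
      to (x ∷ l) y∈  with x∈p∪q⁻ ⁅ x ⁆ (toSubset G l) y∈
      ... | inj₁ y∈⁅x⁆ = here (x∈⁅y⁆⇒x≡y x y∈⁅x⁆)
      ... | inj₂ y∈l   = there (to l y∈l)
      from : ∀ {y} l → y ∈ˡ l → y ∈ toSubset G l
      from (x ∷ l) (here refl) = x∈p∪q⁺ (inj₁ (x∈⁅x⁆ x))
      from (x ∷ l) (there y∈l) = x∈p∪q⁺ (inj₂ (from l y∈l))

  ∈-suffixFrom⁻ : ∀ {a y} l → y ∈ˡ suffixFrom G a l → y ∈ˡ l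
  ∈-suffixFrom⁻ {a} (x ∷ l) y∈ with x ≟ a
  ... | yes _ = y∈
  ... | no  _ = there (∈-suffixFrom⁻ l y∈)

  ∈-suffixFrom-self : ∀ {a} l → a ∈ˡ l → a ∈ˡ suffixFrom G a l
  ∈-suffixFrom-self {a} (x ∷ l) a∈ with x ≟ a | a∈
  ... | yes _   | _         = a∈
  ... | no  x≢a | here a≡x  = contradiction (sym a≡x) x≢a
  ... | no  _   | there a∈l = ∈-suffixFrom-self l a∈l

  suffixFrom-map : ∀ {f : Fin m → Fin m} → Injective _≡_ _≡_ f → ∀ a l →
                   suffixFrom G (f a) (map f l) ≡ map f (suffixFrom G a l)
  suffixFrom-map f-inj a []      = refl
  suffixFrom-map {f} f-inj a (x ∷ l) with x ≟ a
  ... | yes refl rewrite dec-true (f x ≟ f x) refl = refl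
  ... | no  x≢a  rewrite dec-false (f x ≟ f a) (x≢a ∘ f-inj) = suffixFrom-map f-inj a l

  Sge-⊆ : ∀ {X : Subset m} a l → All (_∈ X) l → Sge G a l ⊆ X
  Sge-⊆ a l l⊆X y∈ = All.lookup l⊆X (∈-suffixFrom⁻ l (Equivalence.to (∈-toSubset (suffixFrom G a l)) y∈))

  ∈-Sge-self : ∀ {a} l → a ∈ˡ l → a ∈ Sge G a l
  ∈-Sge-self l a∈l = Equivalence.from (∈-toSubset _) (∈-suffixFrom-self l a∈l)

  ∈-Sge-transpose : ∀ (s s' : Fin m) l {y} →
                    y ∈ Sge G s' (map (transpose s s') l) ⇔ transpose s s' y ∈ Sge G s l
  ∈-Sge-transpose s s' l {y} = subst (λ T → y ∈ T ⇔ τ y ∈ Sge G s l) (sym Sge-s'-τ)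
    (⇔-sym (∈-toSubset suffix) ⇔-∘ (∈-map-involutive (transpose-involutive s s') suffix ⇔-∘ ∈-toSubset (map τ suffix)))
    where
      τ : Fin m → Fin m
      τ = transpose s s'
      suffix : List (Fin m)
      suffix = suffixFrom G s l
      Sge-s'-τ : Sge G s' (map τ l) ≡ toSubset G (map τ suffix)
      Sge-s'-τ = begin
        toSubset G (suffixFrom G s' (map τ l))    ≡⟨ cong (λ a → toSubset G (suffixFrom G a (map τ l))) (transpose-matchˡ s s') ⟨
        toSubset G (suffixFrom G (τ s) (map τ l)) ≡⟨ cong (toSubset G) (suffixFrom-map (transpose-injective s s') s l) ⟩
        toSubset G (map τ suffix)                 ∎
        where open ≡-Reasoning

  +0≤valℤ : ∀ v T → + 0 ℤ.≤ valℤ G v T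
  +0≤valℤ v T with v T
  ... | true  = ℤ.+≤+ z≤n
  ... | false = ℤ.+≤+ z≤n

  module _ (v : Subset m → Bool) {s s' : Fin m} (s≢s' : s ≢ s')
           (loses : ∀ T → T ⊆ SSat → s ∈ T → s' ∉ T → v T ≡ false) where

    valℤ-loses-≤ : ∀ {T} U → T ⊆ SSat → s ∈ T → s' ∉ T → valℤ G v T ℤ.≤ valℤ G v U
    valℤ-loses-≤ {T} U T⊆SSat s∈T s'∉T rewrite loses T T⊆SSat s∈T s'∉T = +0≤valℤ v U

    marginal-≤-transpose : ∀ l → s ∈ˡ l → All (_∈ SSat) l →
                           marginal G v s l ℤ.≤ marginal G v s' (map (transpose s s') l)
    marginal-≤-transpose l s∈l l⊆SSat = by-cases (s' ∈? S≥s)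
      where
        open ℤP.≤-Reasoning
        S≥s S≥s' : Subset m
        S≥s  = Sge G s l
        S≥s' = Sge G s' (map (transpose s s') l)
        s∈S≥s : s ∈ S≥s
        s∈S≥s = ∈-Sge-self l s∈l
        S≥s⊆SSat : S≥s ⊆ SSat
        S≥s⊆SSat = Sge-⊆ s l l⊆SSat
        by-cases : Dec (s' ∈ S≥s) → marginal G v s l ℤ.≤ marginal G v s' (map (transpose s s') l)
        by-cases (yes s'∈S≥s) = begin
          valℤ G v S≥s ℤ.- valℤ G v (S≥s - s)    ≤⟨ ℤP.+-monoʳ-≤ (valℤ G v S≥s) (ℤP.neg-mono-≤
                                                       (valℤ-loses-≤ (S≥s - s) (S≥s⊆SSat ∘ p─q⊆p S≥s ⁅ s' ⁆)
                                                         (x∈p∧x≢y⇒x∈p-y s∈S≥s s≢s') (λ s'∈ → x∈p-y⇒x≢y S≥s s'∈ refl))) ⟩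
          valℤ G v S≥s ℤ.- valℤ G v (S≥s - s')   ≡⟨ cong (λ T → valℤ G v T ℤ.- valℤ G v (T - s'))
                                                       (preimage-transpose-≡ (∈-Sge-transpose s s' l) s∈S≥s s'∈S≥s) ⟨
          valℤ G v S≥s' ℤ.- valℤ G v (S≥s' - s') ∎
        by-cases (no s'∉S≥s) = begin
          valℤ G v S≥s ℤ.- valℤ G v (S≥s - s)    ≤⟨ ℤP.+-monoˡ-≤ (ℤ.- valℤ G v (S≥s - s))
                                                       (valℤ-loses-≤ S≥s' S≥s⊆SSat s∈S≥s s'∉S≥s) ⟩
          valℤ G v S≥s' ℤ.- valℤ G v (S≥s - s)   ≡⟨ cong (λ T → valℤ G v S≥s' ℤ.- valℤ G v T)
                                                       (preimage-transpose-─ (∈-Sge-transpose s s' l) s'∉S≥s) ⟨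
          valℤ G v S≥s' ℤ.- valℤ G v (S≥s' - s') ∎

-- Only the Boolean function v enters the argument.
mainTheorem1 : ∀ {m} (G : Game m) (v : Subset m → Bool) → IsVal G v →
    (s s' : Fin m) → s ∈ Game.SSat G → s' ∈ Game.SSat G →
    (∀ (T : Subset m) → T ⊆ Game.SSat G → s ∈ T → s' ∉ T → v T ≡ false) →
    Importance G v s ≤ Importance G v s'
mainTheorem1 {m} G v _ s s' s∈SSat s'∈SSat loses with s ≟ s'
... | yes refl = ℚP.≤-refl
... | no s≢s'  = /-monoˡ-≤ (∣ SSat ∣ !) {{∣ SSat ∣ !≢0}} (begin
  sumℤ G (map (marginal G v s) Π)                         ≤⟨ sumℤ-map-mono G Π marginal≤ ⟩
  sumℤ G (map (marginal G v s' ∘ map (transpose s s')) Π) ≡⟨ sumℤ-perms-transpose G s≢s' (satList-unique G)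
                                                               (∈-satList G s∈SSat) (∈-satList G s'∈SSat) (marginal G v s') ⟩
  sumℤ G (map (marginal G v s') Π)                        ∎)
  where
    open Game G using (SSat)
    open ℤP.≤-Reasoning
    Π : List (List (Fin m))
    Π = perms G (satList G)
    marginal≤ : ∀ {l} → l ∈ˡ Π → marginal G v s l ℤ.≤ marginal G v s' (map (transpose s s') l)
    marginal≤ l∈Π with satList↭l ← ↭-sym (∈-perms⇒↭ G (satList G) l∈Π) =
      marginal-≤-transpose G v s≢s' loses _
        (∈-resp-↭ satList↭l (∈-satList G s∈SSat)) (All-resp-↭ satList↭l (All-∈-satList G))
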